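{- Let $\mathbb X$ be a chainable relational structure and $\mathbb L\in\mathcal L_{\mathbb X}$. Then (a) $\mathrm{Emb}(\mathbb L)\subset\mathrm{Emb}(\mathbb X)$ and $\mathbb P(\mathbb L)\subset\mathbb P(\mathbb X)$; (b) if $\mathbb P(\mathbb L)$ is a dense subset of $\langle\mathbb P(\mathbb X),\subset\rangle$, then $\mathbb B_{\mathbb X}\cong\mathbb B_{\mathbb L}$.
   Context: For a relational structure $\mathbb X$ with domain $X$: $\mathrm{Emb}(\mathbb X)$ is its set of self-embeddings, $\mathbb P(\mathbb X)=\{f[X]:f\in\mathrm{Emb}(\mathbb X)\}$ ordered by $\subset$, and $\mathbb B_{\mathbb X}=\mathrm{ro}(\mathrm{sq}(\mathbb P(\mathbb X)))$, the Boolean completion of the separative quotient of this poset. $\mathrm{Pa}(\mathbb X)$ is the set of partial automorphisms (isomorphisms between substructures). $\mathbb X$ is chainable iff there is a linear order $\lhd$ on $X$ with $\mathrm{Pa}(\langle X,\lhd\rangle)\subset\mathrm{Pa}(\mathbb X)$; $\mathcal L_{\mathbb X}$ is the set of all linear orders $\langle X,\lhd\rangle$ with this property. A linear order is regarded as a structure with one binary relation. -}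

module Defs where

open import Level using (Level; _⊔_) renaming (suc to lsuc; zero to lzero)
open import Data.Nat using (ℕ)
open import Data.Fin using (Fin; zero; suc)
open import Data.Unit using (⊤; tt)
open import Data.Product using (Σ; ∃; ∃-syntax; _×_; _,_; proj₁; proj₂)
open import Data.Sum using (_⊎_)
open import Relation.Nullary using (¬_)
open import Relation.Binary.PropositionalEquality using (_≡_; _≢_)

record Structure : Set₁ where
  field
    Dom : Set
    Idx : Set
    ar  : Idx → ℕ
    Rel : (i : Idx) → (Fin (ar i) → Dom) → Set
open Structure public

_⇔_ : ∀ {a b} → Set a → Set b → Set (a ⊔ b)
A ⇔ B = (A → B) × (B → A)

IsEmb : (S : Structure) → (Dom S → Dom S) → Set
IsEmb S f = (∀ x y → f x ≡ f y → x ≡ y)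
          × (∀ i (v : Fin (ar S i) → Dom S) → Rel S i v ⇔ Rel S i (λ k → f (v k)))

PartialMap : Set → Set₁
PartialMap A = Σ (A → Set) (λ D → Σ A D → A)

IsPartAut : (S : Structure) → PartialMap (Dom S) → Set
IsPartAut S (D , f) =
    (∀ a b → f a ≡ f b → proj₁ a ≡ proj₁ b)
  × (∀ i (v : Fin (ar S i) → Σ (Dom S) D) →
       Rel S i (λ k → proj₁ (v k)) ⇔ Rel S i (λ k → f (v k)))

IsLinearOrder : {A : Set} → (A → A → Set) → Set
IsLinearOrder {A} _◁_ =
    (∀ x → ¬ (x ◁ x))
  × (∀ x y z → x ◁ y → y ◁ z → x ◁ z)
  × (∀ x y → x ≢ y → (x ◁ y) ⊎ (y ◁ x))

LOStruct : (A : Set) → (A → A → Set) → Structure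
LOStruct A _◁_ = record
  { Dom = A ; Idx = ⊤ ; ar = λ _ → 2
  ; Rel = λ _ v → v zero ◁ v (suc zero) }

InL : (S : Structure) → (Dom S → Dom S → Set) → Set₁
InL S _◁_ = IsLinearOrder _◁_
          × (∀ p → IsPartAut (LOStruct (Dom S) _◁_) p → IsPartAut S p)

Chainable : Structure → Set₁
Chainable S = Σ (Dom S → Dom S → Set) (InL S)

Subset : Set → Set₁
Subset A = A → Set

_⊆_ : {A : Set} → Subset A → Subset A → Set
P ⊆ Q = ∀ x → P x → Q x

Image : {A : Set} → (A → A) → Subset A
Image f x = ∃[ y ] (f y ≡ x)

InP : (S : Structure) → Subset (Dom S) → Set
InP S A = Σ (Dom S → Dom S) (λ f → IsEmb S f × (∀ x → A x ⇔ Image f x))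

PCar : Structure → Set₁
PCar S = Σ (Subset (Dom S)) (InP S)

_⊑_ : {S : Structure} → PCar S → PCar S → Set
A ⊑ B = proj₁ A ⊆ proj₁ B

-- ℙ(L) is a dense subset of ⟨ℙ(X),⊂⟩, where 𝕃 = ⟨X,◁⟩ (note ℙ(L) ⊆ ℙ(X) by (a)):
-- every element of ℙ(X) contains some element of ℙ(L) (which is itself in ℙ(X)).
DenseLX : (S : Structure) → (Dom S → Dom S → Set) → Set₁
DenseLX S _◁_ = ∀ (A : PCar S) →
  ∃[ B ] (InP (LOStruct (Dom S) _◁_) B × InP S B × B ⊆ proj₁ A)

module _ {C : Set₁} {ℓ : Level} (_≤_ : C → C → Set ℓ) where

  -- the separative-quotient order: p ≤* q iff every r ≤ p is compatible with q
  -- (sq(P) is the quotient of ⟨C,≤*⟩ by the induced equivalence)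
  _≤sep_ : C → C → Set (lsuc lzero ⊔ ℓ)
  p ≤sep q = ∀ r → r ≤ p → ∃[ s ] (s ≤ r × s ≤ q)

  -- regular open subsets (w.r.t. the topology of down-sets): U = int (cl U)
  IsRegOpen : (C → Set₁) → Set (lsuc lzero ⊔ ℓ)
  IsRegOpen U = ∀ p → U p ⇔ (∀ q → q ≤ p → ∃[ r ] (r ≤ q × U r))

  RO : Set (lsuc (lsuc lzero) ⊔ ℓ)
  RO = Σ (C → Set₁) IsRegOpen

  _⊆RO_ : RO → RO → Set₁
  U ⊆RO V = ∀ p → proj₁ U p → proj₁ V p

𝔹 : {C : Set₁} {ℓ : Level} → (C → C → Set ℓ) → Set (lsuc (lsuc lzero) ⊔ ℓ)
𝔹 _≤_ = RO (_≤sep_ _≤_)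

-- Isomorphism of the complete Boolean algebras 𝔹 P ≅ 𝔹 Q, given as an order
-- isomorphism of the underlying lattices (equivalent to Boolean isomorphism).
_≅𝔹_ : {C D : Set₁} → (C → C → Set) → (D → D → Set) → Set₂
_≅𝔹_ {C} {D} _≤₁_ _≤₂_ =
  Σ (𝔹 _≤₁_ → 𝔹 _≤₂_) λ Φ → Σ (𝔹 _≤₂_ → 𝔹 _≤₁_) λ Ψ →
      (∀ U V → _⊆RO_ (_≤sep_ _≤₁_) U V ⇔ _⊆RO_ (_≤sep_ _≤₂_) (Φ U) (Φ V))
    × (∀ U V → _⊆RO_ (_≤sep_ _≤₂_) U V ⇔ _⊆RO_ (_≤sep_ _≤₁_) (Ψ U) (Ψ V))
    × (∀ U → ∀ p → proj₁ (Ψ (Φ U)) p ⇔ proj₁ U p)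
    × (∀ V → ∀ p → proj₁ (Φ (Ψ V)) p ⇔ proj₁ V p)

module Submission where

open import Defs
open import Data.Product using (Σ; _×_; _,_; proj₁; proj₂)
open import Data.Unit using (⊤; tt)
open import Relation.Binary.Definitions using (Reflexive; Transitive)

-- (a) A self-embedding is a partial automorphism with total domain, so Pa(𝕃) ⊆ Pa(𝕏) gives
-- Emb(𝕃) ⊆ Emb(𝕏), and ℙ(𝕃) ⊆ ℙ(𝕏) follows since both are images of self-embeddings.
-- (b) Under (a), ℙ(𝕃) is a sub-poset of ℙ(𝕏), and a dense sub-poset induces an isomorphism
-- of the regular-open algebras of the separative quotients: a regular open set is
-- determined by its trace on any dense subset.

module _ (S : Structure) where

  total : (Dom S → Dom S) → PartialMap (Dom S)
  total f = (λ _ → ⊤) , λ x → f (proj₁ x)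

  IsEmb⇒IsPartAut-total : ∀ f → IsEmb S f → IsPartAut S (total f)
  IsEmb⇒IsPartAut-total f (injective , preserves) =
      (λ x y → injective (proj₁ x) (proj₁ y))
    , λ i v → preserves i (λ k → proj₁ (v k))

  IsPartAut-total⇒IsEmb : ∀ f → IsPartAut S (total f) → IsEmb S f
  IsPartAut-total⇒IsEmb f (injective , preserves) =
      (λ x y → injective (x , tt) (y , tt))
    , λ i v → preserves i (λ k → v k , tt)

module _ (X : Structure) (_◁_ : Dom X → Dom X → Set)
         (Pa-⊆ : ∀ p → IsPartAut (LOStruct (Dom X) _◁_) p → IsPartAut X p) where

  private
    𝕃 : Structure
    𝕃 = LOStruct (Dom X) _◁_

  Emb-⊆ : ∀ f → IsEmb 𝕃 f → IsEmb X f
  Emb-⊆ f emb =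
    IsPartAut-total⇒IsEmb X f (Pa-⊆ (total 𝕃 f) (IsEmb⇒IsPartAut-total 𝕃 f emb))

  P-⊆ : ∀ A → InP 𝕃 A → InP X A
  P-⊆ A (f , emb , A≡f[X]) = f , Emb-⊆ f emb , A≡f[X]

module _ {C : Set₁} (_≤_ : C → C → Set) where

  ≤sep-trans : Transitive _≤_ → Transitive (_≤sep_ _≤_)
  ≤sep-trans ≤-trans p≤q q≤t r r≤p with p≤q r r≤p
  ... | s , s≤r , s≤q with q≤t s s≤q
  ... | s′ , s′≤s , s′≤t = s′ , ≤-trans s′≤s s≤r , s′≤t

  ≤⇒≤sep : Reflexive _≤_ → Transitive _≤_ → ∀ {p q} → p ≤ q → _≤sep_ _≤_ p q
  ≤⇒≤sep ≤-refl ≤-trans p≤q r r≤p = r , ≤-refl , ≤-trans r≤p p≤q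

  RO-downward : Transitive _≤_ → (U : 𝔹 _≤_) → ∀ {p q} →
                proj₁ U p → _≤sep_ _≤_ q p → proj₁ U q
  RO-downward ≤-trans (U , regular) {p} {q} Up q≤p =
    proj₂ (regular q) λ r r≤q → proj₁ (regular p) Up r (≤sep-trans ≤-trans r≤q q≤p)

module DenseEmbedding {C D : Set₁} (_≤_ : C → C → Set) (_≤′_ : D → D → Set)
  (≤-refl : Reflexive _≤_) (≤-trans : Transitive _≤_) (≤′-trans : Transitive _≤′_)
  (e : D → C) (e-mono : ∀ {d d′} → d ≤′ d′ → e d ≤ e d′)
  (e-reflect : ∀ {d d′} → e d ≤ e d′ → d ≤′ d′)
  (dense : ∀ c → Σ D λ d → e d ≤ c) where

  private
    _≼_ : C → C → Set₁
    _≼_ = _≤sep_ _≤_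

    _≼′_ : D → D → Set₁
    _≼′_ = _≤sep_ _≤′_

    ≼-trans : Transitive _≼_
    ≼-trans = ≤sep-trans _≤_ ≤-trans

    ≼-down : (U : 𝔹 _≤_) → ∀ {p q} → proj₁ U p → q ≼ p → proj₁ U q
    ≼-down = RO-downward _≤_ ≤-trans

    ≼′-down : (V : 𝔹 _≤′_) → ∀ {p q} → proj₁ V p → q ≼′ p → proj₁ V q
    ≼′-down = RO-downward _≤′_ ≤′-trans

  dense-sep : ∀ c → Σ D λ d → e d ≼ c
  dense-sep c = proj₁ (dense c) , ≤⇒≤sep _≤_ ≤-refl ≤-trans (proj₂ (dense c))

  e-mono-sep : ∀ {d d′} → d ≼′ d′ → e d ≼ e d′
  e-mono-sep d≼d′ r r≤ed with dense r
  ... | t , et≤r with d≼d′ t (e-reflect (≤-trans et≤r r≤ed))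
  ... | s , s≤t , s≤d′ = e s , ≤-trans (e-mono s≤t) et≤r , e-mono s≤d′

  e-reflect-sep : ∀ {d d′} → e d ≼ e d′ → d ≼′ d′
  e-reflect-sep ed≼ed′ r r≤d with ed≼ed′ (e r) (e-mono r≤d)
  ... | s , s≤er , s≤ed′ with dense s
  ... | t , et≤s = t , e-reflect (≤-trans et≤s s≤er) , e-reflect (≤-trans et≤s s≤ed′)

  restrict : 𝔹 _≤_ → 𝔹 _≤′_
  restrict (U , regular) = (λ d → U (e d)) , λ d →
      (λ Ued q q≼d →
         let r , r≼eq , Ur = proj₁ (regular (e d)) Ued (e q) (e-mono-sep q≼d)
             s , es≼r = dense-sep r
         in s , e-reflect-sep (≼-trans es≼r r≼eq) , ≼-down (U , regular) Ur es≼r)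
    , (λ h → proj₂ (regular (e d)) λ q q≼ed →
         let q′ , eq′≼q = dense-sep q
             r , r≼q′ , Uer = h q′ (e-reflect-sep (≼-trans eq′≼q q≼ed))
         in e r , ≼-trans (e-mono-sep r≼q′) eq′≼q , Uer)

  -- the interior of the closure of e[V]
  generated : (D → Set₁) → C → Set₁
  generated V c = ∀ q → q ≼ c → Σ D λ d → (e d ≼ q) × V d

  generated-⊇ : (V : 𝔹 _≤′_) → ∀ d → proj₁ V d → generated (proj₁ V) (e d)
  generated-⊇ V d Vd q q≼ed =
    let s , es≼q = dense-sep q
    in s , es≼q , ≼′-down V Vd (e-reflect-sep (≼-trans es≼q q≼ed))

  generated-⊆ : (V : 𝔹 _≤′_) → ∀ d → generated (proj₁ V) (e d) → proj₁ V d
  generated-⊆ (V , regular) d h = proj₂ (regular d) λ q q≼d →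
    let s , es≼eq , Vs = h (e q) (e-mono-sep q≼d)
    in s , e-reflect-sep es≼eq , Vs

  generate : 𝔹 _≤′_ → 𝔹 _≤_
  generate V = generated (proj₁ V) , λ c →
      (λ h q q≼c → let d , ed≼q , Vd = h q q≼c in e d , ed≼q , generated-⊇ V d Vd)
    , (λ h q q≼c →
         let r , r≼q , gen-r = h q q≼c
             d , ed≼r , Vd = gen-r r (λ s s≤r → s , ≤-refl , s≤r)
         in d , ≼-trans ed≼r r≼q , Vd)

  RO-from-dense : (U : 𝔹 _≤_) → ∀ c →
                  (∀ q → q ≼ c → ∀ d → e d ≼ q → proj₁ U (e d)) → proj₁ U c
  RO-from-dense U c h = proj₂ (proj₂ U c) λ q q≼c →
    let d , ed≼q = dense-sep q in e d , ed≼q , h q q≼c d ed≼q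

  generate-restrict : ∀ U c → proj₁ (generate (restrict U)) c ⇔ proj₁ U c
  generate-restrict U c =
      (λ h → proj₂ (proj₂ U c) λ q q≼c → let d , ed≼q , Ued = h q q≼c in e d , ed≼q , Ued)
    , (λ Uc q q≼c → let d , ed≼q = dense-sep q in
         d , ed≼q , ≼-down U Uc (≼-trans ed≼q q≼c))

  restrict-mono : ∀ U V → _⊆RO_ _≼_ U V ⇔ _⊆RO_ _≼′_ (restrict U) (restrict V)
  restrict-mono U V =
      (λ U⊆V d → U⊆V (e d))
    , (λ h c Uc → RO-from-dense V c λ q q≼c d ed≼q →
         h d (≼-down U Uc (≼-trans ed≼q q≼c)))

  generate-mono : ∀ U V → _⊆RO_ _≼′_ U V ⇔ _⊆RO_ _≼_ (generate U) (generate V)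
  generate-mono U V =
      (λ U⊆V c gen-c q q≼c → let d , ed≼q , Ud = gen-c q q≼c in d , ed≼q , U⊆V d Ud)
    , (λ h d Ud → generated-⊆ V d (h (e d) (generated-⊇ U d Ud)))

  ≅𝔹 : _≅𝔹_ _≤_ _≤′_
  ≅𝔹 = restrict , generate , restrict-mono , generate-mono , generate-restrict
     , λ V d → generated-⊆ V d , generated-⊇ V d

module _ {S : Structure} where

  ⊑-refl : Reflexive (_⊑_ {S})
  ⊑-refl x Ax = Ax

  ⊑-trans : Transitive (_⊑_ {S})
  ⊑-trans A⊑B B⊑C x Ax = B⊑C x (A⊑B x Ax)

proposition4p1 : (X : Structure) → Chainable X →
    (_◁_ : Dom X → Dom X → Set) → InL X _◁_ →
    ( (∀ f → IsEmb (LOStruct (Dom X) _◁_) f → IsEmb X f)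
    × (∀ A → InP (LOStruct (Dom X) _◁_) A → InP X A) )
    × ( DenseLX X _◁_ →
    _≅𝔹_ (_⊑_ {X}) (_⊑_ {LOStruct (Dom X) _◁_}) )
-- _⊑_ unfolds to inclusion of first projections, so the implicit end points of
-- ⊑-refl and ⊑-trans cannot be inferred and are passed explicitly.
proposition4p1 X _ _◁_ (_ , Pa-⊆) =
  (Emb-⊆ X _◁_ Pa-⊆ , P-⊆ X _◁_ Pa-⊆) , λ dense →
    DenseEmbedding.≅𝔹 (_⊑_ {X}) (_⊑_ {𝕃})
      (λ {A} → ⊑-refl {X} {A}) (λ {A B C} → ⊑-trans {X} {A} {B} {C})
      (λ {A B C} → ⊑-trans {𝕃} {A} {B} {C})
      (λ (A , A∈P𝕃) → A , P-⊆ X _◁_ Pa-⊆ A A∈P𝕃) (λ A⊆B → A⊆B) (λ A⊆B → A⊆B)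
      (λ A → let B , B∈P𝕃 , _ , B⊆A = dense A in (B , B∈P𝕃) , B⊆A)
  where
    𝕃 : Structure
    𝕃 = LOStruct (Dom X) _◁_
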